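{- Let $\mathbf{b}=(b_i)_{i\ge0}$ be a sequence of nonzero elements of a field and let $\mathbf{b}^2=(b_{i-1}b_i)_{i\ge1}$. For every Motzkin path $\pi$ from $(0,r)$ to $(n,s)$, \[ \mathrm{wt}(\pi;\mathbf{b},\mathbf{b}^2)=\frac{b_0\cdots b_{r-1}}{b_0\cdots b_s}\,\mathrm{pwt}(\pi;\mathbf{b}), \] where the empty product $b_0\cdots b_{r-1}$ (for $r=0$) equals $1$.
   Context: A Motzkin path is a finite sequence of points in $\mathbb{Z}\times\mathbb{Z}_{\ge0}$ whose steps are each $(1,1)$, $(1,0)$ or $(1,-1)$. For sequences $\mathbf{b}=(b_i)_{i\ge0}$, $\boldsymbol{\lambda}=(\lambda_i)_{i\ge1}$, the weight $\mathrm{wt}(\pi;\mathbf{b},\boldsymbol{\lambda})$ is the product of $b_i$ over horizontal steps starting at height $i$ and $\lambda_i$ over down steps starting at height $i$. The point-weight is $\mathrm{pwt}(\pi;\mathbf{b})=\prod_{(i,j)\in\pi}b_j$, the product over all points $(i,j)$ of $\pi$ (including both endpoints). -}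

module Defs where

open import Level using (Level; _⊔_; suc)
open import Data.Nat using (ℕ; zero) renaming (suc to 1+)
open import Algebra.Bundles using (CommutativeRing)
open import Relation.Nullary using (¬_)

record Field (c ℓ : Level) : Set (suc (c ⊔ ℓ)) where
  field
    commutativeRing : CommutativeRing c ℓ
  open CommutativeRing commutativeRing public
  field
    _⁻¹      : Carrier → Carrier
    0≉1      : ¬ (0# ≈ 1#)
    ⁻¹-inverseʳ : ∀ x → ¬ (x ≈ 0#) → x * (x ⁻¹) ≈ 1#

-- MotzkinPath n r s : paths from (0,r) to (n,s) with steps
-- (1,1), (1,0), (1,-1) staying in ℤ × ℤ_{≥0} (heights are naturals, so a
-- down step is only possible from a positive height).
data MotzkinPath : ℕ → ℕ → ℕ → Set where
  nil  : ∀ {r} → MotzkinPath 0 r r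
  up   : ∀ {n r s} → MotzkinPath n (1+ r) s → MotzkinPath (1+ n) r s
  flat : ∀ {n r s} → MotzkinPath n r s → MotzkinPath (1+ n) r s
  down : ∀ {n r s} → MotzkinPath n r s → MotzkinPath (1+ n) (1+ r) s

module _ {c ℓ} (F : Field c ℓ) where
  open Field F

  -- wt(π; b, λ): product of b_i over horizontal steps starting at height i
  -- and λ_i over down steps starting at height i (i ≥ 1).  λ is given as a
  -- function ℕ → Carrier; only its values at positive indices are used.
  wt : ∀ {n r s} → MotzkinPath n r s → (ℕ → Carrier) → (ℕ → Carrier) → Carrier
  wt nil b lam = 1#
  wt (up p) b lam = wt p b lam
  wt (flat {r = r} p) b lam = b r * wt p b lam
  wt (down {r = r} p) b lam = lam (1+ r) * wt p b lam

  pwt : ∀ {n r s} → MotzkinPath n r s → (ℕ → Carrier) → Carrier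
  pwt (nil {r}) b = b r
  pwt (up {r = r} p) b = b r * pwt p b
  pwt (flat {r = r} p) b = b r * pwt p b
  pwt (down {r = r} p) b = b (1+ r) * pwt p b

  -- b² = (b_{i-1} b_i)_{i ≥ 1}; the value at index 0 is irrelevant (set to 1).
  sq : (ℕ → Carrier) → ℕ → Carrier
  sq b zero = 1#
  sq b (1+ i) = b i * b (1+ i)

  prodTo : (ℕ → Carrier) → ℕ → Carrier
  prodTo b zero = 1#
  prodTo b (1+ k) = prodTo b k * b k

{-# OPTIONS --safe #-}
module Submission where

-- Clearing the denominator, the claim reads  b₀⋯b_s · wt(π; b, b²) = b₀⋯b_{r-1} · pwt(π; b),
-- which holds for every sequence b and follows by induction on π: prepending a step from
-- height h multiplies both sides by the same amount.  For a down step the weight b_{h-1} b_h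
-- pays for the new point (b_h) and for the change b₀⋯b_{h-2} ↦ b₀⋯b_{h-1} of the prefactor;
-- for an up step the prefactor change alone accounts for the new point.  Nonzeroness of the
-- b_i is needed only to divide by b₀⋯b_s at the end.

open import Defs
open import Data.Nat using (ℕ) renaming (suc to 1+; zero to 0ℕ)
open import Relation.Nullary using (¬_)
import Algebra.Properties.CommutativeSemigroup as CommutativeSemigroupProperties
import Relation.Binary.Reasoning.Setoid as SetoidReasoning

module _ {c ℓ} (F : Field c ℓ) where
  open Field F
  open CommutativeSemigroupProperties *-commutativeSemigroup
  open SetoidReasoning setoid

  x*y≈z⇒y≈z*x⁻¹ : ∀ {x y z} → ¬ (x ≈ 0#) → x * y ≈ z → y ≈ z * x ⁻¹
  x*y≈z⇒y≈z*x⁻¹ {x} {y} {z} x≉0 xy≈z = begin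
    y                 ≈⟨ *-identityʳ y ⟨
    y * 1#            ≈⟨ *-congˡ (⁻¹-inverseʳ x x≉0) ⟨
    y * (x * x ⁻¹)    ≈⟨ x∙yz≈xy∙z y x (x ⁻¹) ⟩
    (y * x) * x ⁻¹    ≈⟨ *-congʳ (trans (*-comm y x) xy≈z) ⟩
    z * x ⁻¹          ∎

  x≉0∧y≉0⇒x*y≉0 : ∀ {x y} → ¬ (x ≈ 0#) → ¬ (y ≈ 0#) → ¬ (x * y ≈ 0#)
  x≉0∧y≉0⇒x*y≉0 {x} {y} x≉0 y≉0 xy≈0 = x≉0 (begin
    x                 ≈⟨ x*y≈z⇒y≈z*x⁻¹ y≉0 (*-comm y x) ⟩
    (x * y) * y ⁻¹    ≈⟨ *-congʳ xy≈0 ⟩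
    0# * y ⁻¹         ≈⟨ zeroˡ (y ⁻¹) ⟩
    0#                ∎)

  prodTo-nonzero : (b : ℕ → Carrier) → (∀ i → ¬ (b i ≈ 0#)) →
                   ∀ k → ¬ (prodTo F b k ≈ 0#)
  prodTo-nonzero b b≉0 0ℕ     1≈0 = 0≉1 (sym 1≈0)
  prodTo-nonzero b b≉0 (1+ k)     = x≉0∧y≉0⇒x*y≉0 (prodTo-nonzero b b≉0 k) (b≉0 k)

  prepend-factors : ∀ {q w p′ v f p g} → q * w ≈ p′ * v → f * p′ ≈ p * g →
                    q * (f * w) ≈ p * (g * v)
  prepend-factors {q} {w} {p′} {v} {f} {p} {g} qw≈p′v fp′≈pg = begin
    q * (f * w)     ≈⟨ x∙yz≈y∙xz q f w ⟩
    f * (q * w)     ≈⟨ *-congˡ qw≈p′v ⟩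
    f * (p′ * v)    ≈⟨ x∙yz≈xy∙z f p′ v ⟩
    (f * p′) * v    ≈⟨ *-congʳ fp′≈pg ⟩
    (p * g) * v     ≈⟨ *-assoc p g v ⟩
    p * (g * v)     ∎

  prodTo-*-wt-sq : (b : ℕ → Carrier) → ∀ {n r s} (π : MotzkinPath n r s) →
                   prodTo F b (1+ s) * wt F π b (sq F b) ≈ prodTo F b r * pwt F π b
  prodTo-*-wt-sq b nil              = *-identityʳ _
  prodTo-*-wt-sq b (up {r = r} π)   =
    trans (prodTo-*-wt-sq b π) (*-assoc (prodTo F b r) (b r) _)
  prodTo-*-wt-sq b (flat {r = r} π) =
    prepend-factors (prodTo-*-wt-sq b π) (*-comm (b r) (prodTo F b r))
  prodTo-*-wt-sq b (down {r = r} π) =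
    prepend-factors (prodTo-*-wt-sq b π) (xy∙z≈zx∙y (b r) (b (1+ r)) (prodTo F b r))

lemma2p8 : ∀ {c ℓ} (F : Field c ℓ) → let open Field F in
    (b : ℕ → Carrier) → (∀ i → ¬ (b i ≈ 0#)) →
    ∀ {n r s} (π : MotzkinPath n r s) →
    wt F π b (sq F b) ≈ (prodTo F b r * (prodTo F b (1+ s)) ⁻¹) * pwt F π b
lemma2p8 F b b≉0 {r = r} {s} π = begin
  wt F π b (sq F b)
    ≈⟨ x*y≈z⇒y≈z*x⁻¹ F (prodTo-nonzero F b b≉0 (1+ s)) (prodTo-*-wt-sq F b π) ⟩
  (prodTo F b r * pwt F π b) * prodTo F b (1+ s) ⁻¹
    ≈⟨ xy∙z≈xz∙y _ _ _ ⟩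
  (prodTo F b r * prodTo F b (1+ s) ⁻¹) * pwt F π b
    ∎
  where
  open Field F
  open CommutativeSemigroupProperties *-commutativeSemigroup
  open SetoidReasoning setoid
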